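{- Let $G=(V,E)$ be a finite simple connected graph, let $k\ge 0$ be an integer, and let $V_1,\ldots,V_t\subseteq V$ satisfy $\bigcup_{i=1}^t V_i=V$. For each $i\in\{1,\ldots,t\}$ let $H_i=\mathrm{hull}(V_i)$. Then $\mu_k(G)\le \sum_{i=1}^t \mu_k(H_i)$.
   Context: A subgraph $H$ of $G$ is convex if for every pair of vertices $u,v\in V(H)$, every shortest $(u,v)$-path in $G$ is entirely contained in $H$. For $S\subseteq V(G)$, the convex hull $\mathrm{hull}(S)$ is the smallest convex subgraph of $G$ containing $S$ (obtained by iteratively adding to $S$ all vertices lying on a shortest path in $G$ between two vertices already in the set). For a graph $F$, $X\subseteq V(F)$ and an integer $k\ge 0$, two vertices $u,v\in V(F)$ are called $(X,k)$-visible in $F$ if there exists a shortest $(u,v)$-path in $F$ having at most $k$ internal vertices that lie in $X$. A set $X\subseteq V(F)$ is a mutual $k$-visible set in $F$ if every pair of distinct vertices of $X$ is $(X,k)$-visible in $F$. The mutual $k$-visibility number $\mu_k(F)$ is the maximum cardinality of a mutual $k$-visible set in $F$. -}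

module Defs where

open import Data.Nat using (ℕ; zero; suc; _+_; _≤_)
open import Data.Bool using (Bool; true; false; T; if_then_else_)
open import Data.Fin using (Fin)
open import Data.Fin.Subset using (Subset; _∈_; ∣_∣)
open import Data.Vec using (lookup)
open import Data.Unit using (⊤)
open import Data.Product using (Σ; _×_; ∃-syntax)
open import Relation.Binary.PropositionalEquality using (_≡_; _≢_)

record Graph (n : ℕ) : Set where
  field
    adj    : Fin n → Fin n → Bool
    irrefl : ∀ i → adj i i ≡ false
    sym    : ∀ i j → adj i j ≡ adj j i
open Graph public

module _ {n : ℕ} (G : Graph n) where

  -- Walks in the induced subgraph G[W] (all vertices satisfy W).
  data Walk (W : Fin n → Set) : Fin n → Fin n → Set where
    stop : ∀ {u} → W u → Walk W u u
    step : ∀ {u v w} → W u → T (adj G u v) → Walk W v w → Walk W u w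

  Full : Fin n → Set
  Full _ = ⊤

  Connected : Set
  Connected = ∀ u v → Walk Full u v

module _ {n : ℕ} {G : Graph n} {W : Fin n → Set} where

  len : ∀ {u v} → Walk G W u v → ℕ
  len (stop _)     = 0
  len (step _ _ p) = suc (len p)

  data OnWalk (x : Fin n) : ∀ {u v} → Walk G W u v → Set where
    here-stop : ∀ {h} → OnWalk x (stop {u = x} h)
    here-step : ∀ {v w h e} {p : Walk G W v w} → OnWalk x (step {u = x} h e p)
    there     : ∀ {u v w h e} {p : Walk G W v w} → OnWalk x p → OnWalk x (step {u = u} h e p)

  cntButLast : Subset n → ∀ {u v} → Walk G W u v → ℕ
  cntButLast X (stop _) = 0
  cntButLast X (step {u = u} _ _ p) = (if lookup X u then 1 else 0) + cntButLast X p

  cntInner : Subset n → ∀ {u v} → Walk G W u v → ℕ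
  cntInner X (stop _)     = 0
  cntInner X (step _ _ p) = cntButLast X p

Shortest : ∀ {n} (G : Graph n) (W : Fin n → Set) {u v} → Walk G W u v → Set
Shortest G W {u} {v} p = ∀ (q : Walk G W u v) → len p ≤ len q

-- convex vertex sets of G (convex subgraphs are induced on such sets)
Convex : ∀ {n} (G : Graph n) → Subset n → Set
Convex G C = ∀ u v → u ∈ C → v ∈ C → (p : Walk G (Full G) u v) → Shortest G (Full G) p →
             ∀ x → OnWalk x p → x ∈ C

Hull : ∀ {n} (G : Graph n) → Subset n → Fin n → Set
Hull G S x = ∀ (C : Subset n) → Convex G C → (∀ y → y ∈ S → y ∈ C) → x ∈ C
  where n = _

MutualVisible : ∀ {n} (G : Graph n) (W : Fin n → Set) (k : ℕ) → Subset n → Set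
MutualVisible G W k X =
  (∀ x → x ∈ X → W x) ×
  (∀ u v → u ∈ X → v ∈ X → u ≢ v →
     Σ (Walk G W u v) λ p → Shortest G W p × cntInner X p ≤ k)

IsMu : ∀ {n} (G : Graph n) (W : Fin n → Set) (k m : ℕ) → Set
IsMu {n} G W k m =
  (∃[ X ] (MutualVisible G W k X × ∣ X ∣ ≡ m)) ×
  (∀ (X : Subset n) → MutualVisible G W k X → ∣ X ∣ ≤ m)

{-# OPTIONS --safe #-}
-- Take a maximum mutual k-visible set X of G. Every piece X ∩ V i lies in the convex set hull(V i),
-- so a shortest path of G between two of its vertices is also a shortest path of H i; it meets
-- X ∩ V i in no more internal vertices than it meets X, hence X ∩ V i is mutual k-visible in H i
-- and ∣ X ∩ V i ∣ ≤ μ_k(H i). Since the V i cover V, ∣ X ∣ ≤ Σ ∣ X ∩ V i ∣.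
module Submission where

open import Defs hiding (sym)
open import Data.Bool using (if_then_else_)
open import Data.Fin using (Fin)
open import Data.Fin.Subset using (Subset; _∈_; _⊆_; _∩_; _∪_; ⋃; ∣_∣; inside; outside)
open import Data.Fin.Subset.Properties using (∣⊥∣≡0; x∈p∩q⁺; x∈p∩q⁻; x∈p∪q⁺; p∩q⊆p; p⊆q⇒∣p∣≤∣q∣)
open import Data.List using (List; []; _∷_; map; allFin)
open import Data.List.Properties using (map-∘)
open import Data.List.Relation.Unary.Any using (here; there)
open import Data.List.Membership.Propositional renaming (_∈_ to _∈ₗ_)
open import Data.List.Membership.Propositional.Properties using (∈-map⁺; ∈-allFin)
open import Data.Nat using (ℕ; _≤_; _+_; suc; z≤n; s≤s)
open import Data.Nat.ListAction using (sum)
open import Data.Nat.Properties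
  using (≤-refl; ≤-trans; ≤-reflexive; +-mono-≤; +-monoʳ-≤; +-suc; n≤1+n; module ≤-Reasoning)
open import Data.Product using (Σ; ∃-syntax; _×_; _,_; proj₂)
open import Data.Sum using (inj₁; inj₂)
open import Data.Vec using ([]; _∷_; lookup)
open import Data.Vec.Properties using ([]=⇒lookup; lookup⇒[]=)
open import Relation.Binary.PropositionalEquality using (_≡_; _≢_; refl; cong; sym; subst)

∣p∪q∣≤∣p∣+∣q∣ : ∀ {n} (p q : Subset n) → ∣ p ∪ q ∣ ≤ ∣ p ∣ + ∣ q ∣
∣p∪q∣≤∣p∣+∣q∣ []            []            = z≤n
∣p∪q∣≤∣p∣+∣q∣ (inside  ∷ p) (inside  ∷ q) = s≤s (≤-trans (∣p∪q∣≤∣p∣+∣q∣ p q) (+-monoʳ-≤ ∣ p ∣ (n≤1+n ∣ q ∣)))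
∣p∪q∣≤∣p∣+∣q∣ (inside  ∷ p) (outside ∷ q) = s≤s (∣p∪q∣≤∣p∣+∣q∣ p q)
∣p∪q∣≤∣p∣+∣q∣ (outside ∷ p) (inside  ∷ q) = ≤-trans (s≤s (∣p∪q∣≤∣p∣+∣q∣ p q)) (≤-reflexive (sym (+-suc ∣ p ∣ ∣ q ∣)))
∣p∪q∣≤∣p∣+∣q∣ (outside ∷ p) (outside ∷ q) = ∣p∪q∣≤∣p∣+∣q∣ p q

∣⋃ps∣≤sum∣ps∣ : ∀ {n} (ps : List (Subset n)) → ∣ ⋃ ps ∣ ≤ sum (map ∣_∣ ps)
∣⋃ps∣≤sum∣ps∣ {n} []       = ≤-reflexive (∣⊥∣≡0 n)
∣⋃ps∣≤sum∣ps∣     (p ∷ ps) = ≤-trans (∣p∪q∣≤∣p∣+∣q∣ p (⋃ ps)) (+-monoʳ-≤ ∣ p ∣ (∣⋃ps∣≤sum∣ps∣ ps))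

x∈⋃⁺ : ∀ {n} {x : Fin n} {p ps} → p ∈ₗ ps → x ∈ p → x ∈ ⋃ ps
x∈⋃⁺ (here refl) x∈p = x∈p∪q⁺ (inj₁ x∈p)
x∈⋃⁺ (there p∈ps) x∈p = x∈p∪q⁺ (inj₂ (x∈⋃⁺ p∈ps x∈p))

sum-map-mono : ∀ {A : Set} {f g : A → ℕ} → (∀ a → f a ≤ g a) → ∀ as → sum (map f as) ≤ sum (map g as)
sum-map-mono f≤g []       = z≤n
sum-map-mono f≤g (a ∷ as) = +-mono-≤ (f≤g a) (sum-map-mono f≤g as)

∣p∣≤sum∣p∩covering∣ : ∀ {n} {A : Set} (V : A → Subset n) (as : List A) (p : Subset n) →
  (∀ {x} → x ∈ p → ∃[ a ] (a ∈ₗ as × x ∈ V a)) →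
  ∣ p ∣ ≤ sum (map (λ a → ∣ p ∩ V a ∣) as)
∣p∣≤sum∣p∩covering∣ V as p covers = begin
  ∣ p ∣                               ≤⟨ p⊆q⇒∣p∣≤∣q∣ p⊆⋃ ⟩
  ∣ ⋃ pieces ∣                        ≤⟨ ∣⋃ps∣≤sum∣ps∣ pieces ⟩
  sum (map ∣_∣ pieces)                ≡⟨ cong sum (map-∘ as) ⟨
  sum (map (λ a → ∣ p ∩ V a ∣) as)    ∎
  where
  open ≤-Reasoning
  pieces : List (Subset _)
  pieces = map (λ a → p ∩ V a) as
  p⊆⋃ : p ⊆ ⋃ pieces
  p⊆⋃ x∈p with covers x∈p
  ... | a , a∈as , x∈Va = x∈⋃⁺ (∈-map⁺ (λ a → p ∩ V a) a∈as) (x∈p∩q⁺ (x∈p , x∈Va))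

-- Convex for vertex predicates rather than bit-vector subsets, so that it applies to Hull.
ConvexPred : ∀ {n} (G : Graph n) → (Fin n → Set) → Set
ConvexPred G W = ∀ {u v} → W u → W v → (p : Walk G (Full G) u v) → Shortest G (Full G) p →
                 ∀ x → OnWalk x p → W x

Hull-convex : ∀ {n} (G : Graph n) (S : Subset n) → ConvexPred G (Hull G S)
Hull-convex G S u∈H v∈H p p-shortest x x∈p C C-convex S⊆C =
  C-convex _ _ (u∈H C C-convex S⊆C) (v∈H C C-convex S⊆C) p p-shortest x x∈p

∈⇒∈Hull : ∀ {n} (G : Graph n) {S : Subset n} {x} → x ∈ S → Hull G S x
∈⇒∈Hull G x∈S C _ S⊆C = S⊆C _ x∈S

module _ {n : ℕ} {G : Graph n} {W : Fin n → Set} where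

  forget : ∀ {u v} → Walk G W u v → Walk G (Full G) u v
  forget (stop _)     = stop _
  forget (step _ e p) = step _ e (forget p)

  len-forget : ∀ {u v} (p : Walk G W u v) → len (forget p) ≡ len p
  len-forget (stop _)     = refl
  len-forget (step _ e p) = cong suc (len-forget p)

  restrict : ∀ {u v} (p : Walk G (Full G) u v) → (∀ x → OnWalk x p → W x) → Walk G W u v
  restrict (stop _)     p⊆W = stop (p⊆W _ here-stop)
  restrict (step _ e p) p⊆W = step (p⊆W _ here-step) e (restrict p (λ x x∈p → p⊆W x (there x∈p)))

  len-restrict : ∀ {u v} (p : Walk G (Full G) u v) (p⊆W : ∀ x → OnWalk x p → W x) →
    len (restrict p p⊆W) ≡ len p
  len-restrict (stop _)     _ = refl
  len-restrict (step _ e p) _ = cong suc (len-restrict p _)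

  cntButLast-restrict : ∀ X {u v} (p : Walk G (Full G) u v) (p⊆W : ∀ x → OnWalk x p → W x) →
    cntButLast X (restrict p p⊆W) ≡ cntButLast X p
  cntButLast-restrict X (stop _)     _ = refl
  cntButLast-restrict X (step _ e p) _ = cong (_ +_) (cntButLast-restrict X p _)

  cntInner-restrict : ∀ X {u v} (p : Walk G (Full G) u v) (p⊆W : ∀ x → OnWalk x p → W x) →
    cntInner X (restrict p p⊆W) ≡ cntInner X p
  cntInner-restrict X (stop _)     _ = refl
  cntInner-restrict X (step _ e p) _ = cntButLast-restrict X p _

  shortest-restrict : ∀ {u v} (p : Walk G (Full G) u v) (p⊆W : ∀ x → OnWalk x p → W x) →
    Shortest G (Full G) p → Shortest G W (restrict p p⊆W)
  shortest-restrict p p⊆W p-shortest q = begin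
    len (restrict p p⊆W)  ≡⟨ len-restrict p p⊆W ⟩
    len p                 ≤⟨ p-shortest (forget q) ⟩
    len (forget q)        ≡⟨ len-forget q ⟩
    len q                 ∎
    where open ≤-Reasoning

module _ {n : ℕ} {G : Graph n} {W : Fin n → Set} {X Y : Subset n} (X⊆Y : X ⊆ Y) where

  indicator-mono : ∀ u → (if lookup X u then 1 else 0) ≤ (if lookup Y u then 1 else 0)
  indicator-mono u with lookup X u in eq
  ... | outside = z≤n
  ... | inside rewrite []=⇒lookup (X⊆Y (lookup⇒[]= u X eq)) = ≤-refl

  cntButLast-mono : ∀ {u v} (p : Walk G W u v) → cntButLast X p ≤ cntButLast Y p
  cntButLast-mono (stop _)             = z≤n
  cntButLast-mono (step {u = u} _ _ p) = +-mono-≤ (indicator-mono u) (cntButLast-mono p)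

  cntInner-mono : ∀ {u v} (p : Walk G W u v) → cntInner X p ≤ cntInner Y p
  cntInner-mono (stop _)     = z≤n
  cntInner-mono (step _ _ p) = cntButLast-mono p

module _ {n : ℕ} {G : Graph n} {k : ℕ} where

  PairwiseVisible : (Fin n → Set) → Subset n → Set
  PairwiseVisible W X = ∀ u v → u ∈ X → v ∈ X → u ≢ v →
    Σ (Walk G W u v) λ p → Shortest G W p × cntInner X p ≤ k

  pairwiseVisible-⊆ : ∀ {W} {X Y : Subset n} → X ⊆ Y → PairwiseVisible W Y → PairwiseVisible W X
  pairwiseVisible-⊆ X⊆Y Y-visible u v u∈X v∈X u≢v with Y-visible u v (X⊆Y u∈X) (X⊆Y v∈X) u≢v
  ... | p , p-shortest , cnt≤k = p , p-shortest , ≤-trans (cntInner-mono X⊆Y p) cnt≤k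

  pairwiseVisible-convex : ∀ {W} {X : Subset n} → ConvexPred G W → (∀ x → x ∈ X → W x) →
    PairwiseVisible (Full G) X → PairwiseVisible W X
  pairwiseVisible-convex {W} {X} W-convex X⊆W X-visible u v u∈X v∈X u≢v
    with X-visible u v u∈X v∈X u≢v
  ... | p , p-shortest , cnt≤k =
    restrict p p⊆W , shortest-restrict p p⊆W p-shortest ,
    subst (_≤ k) (sym (cntInner-restrict X p p⊆W)) cnt≤k
    where
    p⊆W : ∀ x → OnWalk x p → W x
    p⊆W = W-convex (X⊆W u u∈X) (X⊆W v v∈X) p p-shortest

  mutualVisible-⊆ : ∀ {W} {X Y : Subset n} → X ⊆ Y → MutualVisible G W k Y → MutualVisible G W k X
  mutualVisible-⊆ X⊆Y (Y⊆W , Y-visible) = (λ x x∈X → Y⊆W x (X⊆Y x∈X)) , pairwiseVisible-⊆ X⊆Y Y-visible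

  mutualVisible-convex : ∀ {W} {X : Subset n} → ConvexPred G W → (∀ x → x ∈ X → W x) →
    MutualVisible G (Full G) k X → MutualVisible G W k X
  mutualVisible-convex W-convex X⊆W (_ , X-visible) = X⊆W , pairwiseVisible-convex W-convex X⊆W X-visible

proposition3p5 : ∀ {n} (G : Graph n) → Connected G → (k t : ℕ) (V : Fin t → Subset n) →
    (∀ x → ∃[ i ] (x ∈ V i)) →
    (m : ℕ) (μH : Fin t → ℕ) →
    IsMu G (Full G) k m →
    (∀ i → IsMu G (Hull G (V i)) k (μH i)) →
    m ≤ sum (map μH (allFin t))
proposition3p5 G _ k t V covers m μH ((X , X-visible , ∣X∣≡m) , _) μH-bound = begin
  m                                          ≡⟨ ∣X∣≡m ⟨
  ∣ X ∣                                      ≤⟨ ∣p∣≤sum∣p∩covering∣ V (allFin t) X covers-X ⟩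
  sum (map (λ i → ∣ X ∩ V i ∣) (allFin t))   ≤⟨ sum-map-mono piece-bound (allFin t) ⟩
  sum (map μH (allFin t))                    ∎
  where
  open ≤-Reasoning
  covers-X : ∀ {x} → x ∈ X → ∃[ i ] (i ∈ₗ allFin t × x ∈ V i)
  covers-X {x} _ = let i , x∈Vi = covers x in i , ∈-allFin i , x∈Vi
  piece-visible : ∀ i → MutualVisible G (Hull G (V i)) k (X ∩ V i)
  piece-visible i = mutualVisible-convex (Hull-convex G (V i))
    (λ x x∈piece → ∈⇒∈Hull G (proj₂ (x∈p∩q⁻ X (V i) x∈piece)))
    (mutualVisible-⊆ (p∩q⊆p X (V i)) X-visible)
  piece-bound : ∀ i → ∣ X ∩ V i ∣ ≤ μH i
  piece-bound i = proj₂ (μH-bound i) (X ∩ V i) (piece-visible i)
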